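{- Let $G$ be a graph and $\mathcal{P}=\{V_1,\dots,V_t\}$ a partition of $V(G)$ such that each $V_i$ induces a clique in $G$. Let $\mathcal{C}=\{C_1,\dots,C_k\}$, $k\ge 1$, be a set of vertex-disjoint cycles in $G$. Then there is a set of vertex-disjoint cycles $\mathcal{C}'=\{C'_1,\dots,C'_{k'}\}$ with $k'\le k$ and $V(\mathcal{C}')=V(\mathcal{C})$ such that: (1) for every $V_i\in\mathcal{P}$ there is at most one cycle $C'\in\mathcal{C}'$ with $V(C')\subseteq V_i$; (2) for every distinct $V_i,V_j\in\mathcal{P}$ there is at most one cycle $C'\in\mathcal{C}'$ with $E(V_i,V_j)\cap E(C')\ne\emptyset$, and for such a cycle $|E(V_i,V_j)\cap E(C')|\le 2$.
   Context: For a collection of cycles $\mathcal{C}$, $V(\mathcal{C})$ is the union of their vertex sets. For disjoint $U,W\subseteq V(G)$, $E(U,W)$ is the set of edges of $G$ with one endpoint in $U$ and the other in $W$. -}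

module Defs where

open import Data.Nat using (ℕ; _≤_)
open import Data.Fin using (Fin; _≟_)
open import Data.List using (List; []; _∷_; _++_; zip; length; filter; lookup)
open import Data.List.Relation.Unary.All using (All)
open import Data.List.Relation.Unary.Any using (Any)
open import Data.List.Relation.Unary.Unique.Propositional using (Unique)
open import Data.List.Relation.Unary.AllPairs using (AllPairs)
open import Data.List.Membership.Propositional using (_∈_; _∉_)
open import Data.Product using (_×_; _,_)
open import Data.Sum using (_⊎_)
open import Relation.Binary.PropositionalEquality using (_≡_; _≢_)
open import Relation.Nullary using (¬_)
open import Relation.Nullary.Decidable using (_×-dec_; _⊎-dec_)
open import Function.Bundles using (_⇔_)

record Graph (n : ℕ) : Set₁ where
  field
    Adj     : Fin n → Fin n → Set
    sym     : ∀ {u v} → Adj u v → Adj v u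
    irrefl  : ∀ {u} → ¬ Adj u u
open Graph public

rotate : {A : Set} → List A → List A
rotate []       = []
rotate (x ∷ xs) = xs ++ (x ∷ [])

cycEdges : {A : Set} → List A → List (A × A)
cycEdges xs = zip xs (rotate xs)

record Cycle {n : ℕ} (G : Graph n) : Set where
  field
    verts    : List (Fin n)
    len≥3    : 3 ≤ length verts
    distinct : Unique verts
    adjacent : All (λ e → Adj G (Data.Product.proj₁ e) (Data.Product.proj₂ e)) (cycEdges verts)
open Cycle public

-- E(C): the edges of a cycle (as ordered pairs along the cycle; each edge occurs once).
edges : ∀ {n} {G : Graph n} → Cycle G → List (Fin n × Fin n)
edges C = cycEdges (verts C)

-- A partition of V(G) into parts V_0..V_{t-1}, given by the part-assignment map.
Partition : ℕ → ℕ → Set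
Partition n t = Fin n → Fin t

PartsAreCliques : ∀ {n t} → Graph n → Partition n t → Set
PartsAreCliques G P = ∀ u v → u ≢ v → P u ≡ P v → Adj G u v

-- Vertex-disjoint collection of cycles (a list; disjointness makes entries distinct).
Disjoint : ∀ {n} {G : Graph n} → Cycle G → Cycle G → Set
Disjoint C D = ∀ v → v ∈ verts C → v ∉ verts D

VertexDisjoint : ∀ {n} {G : Graph n} → List (Cycle G) → Set
VertexDisjoint = AllPairs Disjoint

InV : ∀ {n} {G : Graph n} → List (Cycle G) → Fin n → Set
InV cs v = Any (λ C → v ∈ verts C) cs

Crosses : ∀ {n t} → Partition n t → Fin t → Fin t → Fin n × Fin n → Set
Crosses P i j (u , v) = (P u ≡ i × P v ≡ j) ⊎ (P u ≡ j × P v ≡ i)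

crosses? : ∀ {n t} (P : Partition n t) i j e → Relation.Nullary.Dec (Crosses P i j e)
crosses? P i j (u , v) = ((P u ≟ i) ×-dec (P v ≟ j)) ⊎-dec ((P u ≟ j) ×-dec (P v ≟ i))

crossCount : ∀ {n t} {G : Graph n} → Partition n t → Fin t → Fin t → Cycle G → ℕ
crossCount P i j C = length (filter (crosses? P i j) (edges C))

MeetsCross : ∀ {n t} {G : Graph n} → Partition n t → Fin t → Fin t → Cycle G → Set
MeetsCross P i j C = Any (Crosses P i j) (edges C)

InsidePart : ∀ {n t} {G : Graph n} → Partition n t → Fin t → Cycle G → Set
InsidePart P i C = All (λ v → P v ≡ i) (verts C)

AtMostOne : ∀ {n} {G : Graph n} → (Cycle G → Set) → List (Cycle G) → Set
AtMostOne Q cs = ∀ a b → Q (lookup cs a) → Q (lookup cs b) → a ≡ b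

module Submission where

-- The collection is rewired until no rule applies; every rewiring keeps V(𝒞) and decreases
-- the potential (number of cycles) + (number of edges joining distinct parts). Since parts are
-- cliques, two disjoint walks close into one cycle whenever each ends in the part where the
-- other starts, and the two closing edges then lie inside parts. Two cycles inside one part
-- are opened anywhere and joined. Two cycles meeting E(Vᵢ,Vⱼ) are opened at such edges and
-- joined, one of them reversed if the two edges point the same way; either merge loses a
-- cycle. A cycle with three edges in E(Vᵢ,Vⱼ) has two pointing from Vᵢ to Vⱼ; cutting it at
-- both and rejoining one piece reversed trades them for edges inside parts.

open import Defs hiding (sym)
open import Data.Nat using (ℕ; zero; suc; _+_; _≤_; _<_; z≤n; s≤s; _≤?_)
open import Data.Nat.Properties
  using (module ≤-Reasoning; ≤-refl; ≤-trans; ≤-reflexive; +-mono-≤; +-monoʳ-≤; +-monoʳ-<; +-monoˡ-≤; +-monoˡ-<; +-mono-<-≤; +-mono-≤-<; +-assoc; n≤1+n; +-identityʳ; m≤m+n; m≤n+m; +-cancelʳ-≤; +-commutativeSemigroup; ≰⇒>)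
open import Data.Nat.ListAction using (sum)
open import Data.Nat.ListAction.Properties using (sum-↭)
open import Data.Fin using (Fin; _≟_; zero; suc)
open import Data.List using (List; []; _∷_; _++_; zip; length; filter; lookup; map; concatMap)
open import Data.List.Properties using (++-assoc; length-++; length-++-≤ˡ; filter-++; filter-accept; filter-reject)
open import Data.List.Relation.Unary.All as All using (All; []; _∷_; all?)
import Data.List.Relation.Unary.All.Properties as Allₚ
open import Data.List.Relation.Unary.Any using (Any; here; there; any?)
open import Data.List.Relation.Unary.AllPairs as AllPairs using (AllPairs; []; _∷_)
import Data.List.Relation.Unary.AllPairs.Properties as AllPairsₚ
open import Data.List.Relation.Unary.Unique.Propositional using (Unique)
import Data.List.Relation.Unary.Unique.Propositional.Properties as Uniqueₚ
open import Data.List.Membership.Propositional using (_∈_; _∉_; find; lose)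
open import Data.List.Membership.Propositional.Properties
  using (∈-++⁻; ∈-++⁺ˡ; ∈-++⁺ʳ; ∈-∃++; ∈-concatMap⁺; ∈-concatMap⁻; ∈-lookup)
open import Data.List.Relation.Binary.Permutation.Propositional as ↭
  using (_↭_; refl; ↭-refl; ↭-sym; ↭-trans; ↭⇒↭ₛ; module PermutationReasoning)
open import Data.List.Relation.Binary.Permutation.Propositional.Properties
  using (All-resp-↭; ∈-resp-↭; ↭-length; filter-↭; ++-comm; ++⁺; ++⁺ˡ; ++⁺ʳ; ∷↭∷ʳ; shift; shifts; map⁺)
import Data.List.Relation.Binary.Permutation.Setoid.Properties as ↭ₛ
open import Data.Product using (Σ; ∃; ∃₂; _×_; _,_; proj₁; proj₂; swap)
open import Data.Sum using (_⊎_; inj₁; inj₂; map₁; map₂)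
open import Data.Empty using (⊥-elim)
open import Function using (_∘_)
open import Relation.Nullary using (¬_; yes; no; ¬?)
open import Relation.Nullary.Decidable using (_×-dec_)
open import Relation.Unary using (Decidable)
open import Relation.Binary.PropositionalEquality
  using (_≡_; _≢_; refl; sym; trans; cong; cong₂; subst; setoid; module ≡-Reasoning)
open import Function.Bundles using (_⇔_; mk⇔)
open import Data.Nat.Induction using (<-wellFounded)
open import Induction.WellFounded using (Acc; acc)
open import Algebra.Properties.CommutativeSemigroup +-commutativeSemigroup using (interchange)

module _ {A : Set} where

  Unique-resp-↭ : ∀ {xs ys : List A} → xs ↭ ys → Unique xs → Unique ys
  Unique-resp-↭ p = ↭ₛ.Unique-resp-↭ (setoid A) (↭⇒↭ₛ p)

  Unique-++⁻ : ∀ xs {ys : List A} → Unique (xs ++ ys) → Unique ys × (∀ {v} → v ∈ xs → v ∉ ys)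
  Unique-++⁻ [] unique = unique , λ ()
  Unique-++⁻ (x ∷ xs) (x∉ ∷ unique) with Unique-++⁻ xs unique
  ... | unique-ys , disjoint = unique-ys , λ
    { (here refl) v∈ys → All.lookup x∉ (∈-++⁺ʳ xs v∈ys) refl
    ; (there v∈xs) → disjoint v∈xs }

  ∈⇒↭ : ∀ {x : A} {xs} → x ∈ xs → ∃ λ ys → xs ↭ x ∷ ys
  ∈⇒↭ {x} x∈xs with ∈-∃++ x∈xs
  ... | ys , zs , refl = ys ++ zs , shift x ys zs

concatMap-↭ : ∀ {A B : Set} (f : A → List B) {xs ys} → xs ↭ ys → concatMap f xs ↭ concatMap f ys
concatMap-↭ f refl = ↭-refl
concatMap-↭ f (↭.prep x p) = ++⁺ˡ (f x) (concatMap-↭ f p)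
concatMap-↭ f (↭.swap x y p) = ↭-trans (shifts (f x) (f y)) (++⁺ˡ (f y) (++⁺ˡ (f x) (concatMap-↭ f p)))
concatMap-↭ f (↭.trans p q) = ↭-trans (concatMap-↭ f p) (concatMap-↭ f q)

module _ {A : Set} {Q : A → Set} (Q? : Decidable Q) where

  count : List A → ℕ
  count xs = length (filter Q? xs)

  count-++ : ∀ xs ys → count (xs ++ ys) ≡ count xs + count ys
  count-++ xs ys = trans (cong length (filter-++ Q? xs ys)) (length-++ (filter Q? xs))

  count-↭ : ∀ {xs ys} → xs ↭ ys → count xs ≡ count ys
  count-↭ p = ↭-length (filter-↭ Q? p)

  count-accept : ∀ {x} xs → Q x → count (x ∷ xs) ≡ suc (count xs)
  count-accept xs q = cong length (filter-accept Q? q)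

  count-reject : ∀ {x} xs → ¬ Q x → count (x ∷ xs) ≡ count xs
  count-reject xs ¬q = cong length (filter-reject Q? ¬q)

  count-[x]≤1 : ∀ x → count (x ∷ []) ≤ 1
  count-[x]≤1 x with Q? x
  ... | yes _ = s≤s z≤n
  ... | no _ = z≤n

  count>0⇒Any : ∀ xs → 0 < count xs → Any Q xs
  count>0⇒Any (x ∷ xs) pos with Q? x
  ... | yes q = here q
  ... | no _ = there (count>0⇒Any xs pos)

count-⊎ : ∀ {A : Set} {R Q₁ Q₂ : A → Set} (R? : Decidable R) (Q₁? : Decidable Q₁) (Q₂? : Decidable Q₂) →
  (∀ x → R x → Q₁ x ⊎ Q₂ x) → ∀ xs → count R? xs ≤ count Q₁? xs + count Q₂? xs
count-⊎ R? Q₁? Q₂? R⊆Q₁∪Q₂ [] = z≤n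
count-⊎ R? Q₁? Q₂? R⊆Q₁∪Q₂ (x ∷ xs) = begin
  count R? ([ x ] ++ xs)                                ≡⟨ count-++ R? [ x ] xs ⟩
  count R? [ x ] + count R? xs                          ≤⟨ +-mono-≤ head (count-⊎ R? Q₁? Q₂? R⊆Q₁∪Q₂ xs) ⟩
  (count Q₁? [ x ] + count Q₂? [ x ]) + (count Q₁? xs + count Q₂? xs)
                                                        ≡⟨ interchange (count Q₁? [ x ]) (count Q₂? [ x ]) (count Q₁? xs) (count Q₂? xs) ⟩
  (count Q₁? [ x ] + count Q₁? xs) + (count Q₂? [ x ] + count Q₂? xs)
                                                        ≡⟨ sym (cong₂ _+_ (count-++ Q₁? [ x ] xs) (count-++ Q₂? [ x ] xs)) ⟩
  count Q₁? ([ x ] ++ xs) + count Q₂? ([ x ] ++ xs)     ∎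
  where
  open ≤-Reasoning
  [_] : _ → List _
  [ y ] = y ∷ []
  head : count R? [ x ] ≤ count Q₁? [ x ] + count Q₂? [ x ]
  head with R? x
  ... | no _ = z≤n
  ... | yes r with R⊆Q₁∪Q₂ x r
  ...   | inj₁ q = ≤-trans (≤-reflexive (sym (count-accept Q₁? [] q))) (m≤m+n _ _)
  ...   | inj₂ q = ≤-trans (≤-reflexive (sym (count-accept Q₂? [] q))) (m≤n+m _ _)

3≤m+n⇒2≤m⊎2≤n : ∀ m n → 3 ≤ m + n → 2 ≤ m ⊎ 2 ≤ n
3≤m+n⇒2≤m⊎2≤n (suc (suc m)) n _ = inj₁ (s≤s (s≤s z≤n))
3≤m+n⇒2≤m⊎2≤n (suc zero) n (s≤s 2≤n) = inj₂ 2≤n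
3≤m+n⇒2≤m⊎2≤n zero n 3≤n = inj₂ (≤-trans (s≤s (s≤s z≤n)) 3≤n)

Fin-∀-⊎ : ∀ {m} {A : Fin m → Set} {B : Set} → (∀ i → A i ⊎ B) → (∀ i → A i) ⊎ B
Fin-∀-⊎ {zero} f = inj₁ λ ()
Fin-∀-⊎ {suc m} f with f zero | Fin-∀-⊎ (f ∘ suc)
... | inj₂ b | _ = inj₂ b
... | inj₁ _ | inj₂ b = inj₂ b
... | inj₁ a | inj₁ as = inj₁ λ { zero → a ; (suc i) → as i }

Fin-∀≢-⊎ : ∀ {m} {A : Fin m → Fin m → Set} {B : Set} → (∀ i j → i ≢ j → A i j ⊎ B) → (∀ i j → i ≢ j → A i j) ⊎ B
Fin-∀≢-⊎ {A = A} {B} f = Fin-∀-⊎ λ i → Fin-∀-⊎ λ j → ifDistinct i j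
  where
  ifDistinct : ∀ i j → (i ≢ j → A i j) ⊎ B
  ifDistinct i j with i ≟ j
  ... | yes refl = inj₁ λ i≢i → ⊥-elim (i≢i refl)
  ... | no i≢j = map₁ (λ a _ → a) (f i j i≢j)

module _ {A : Set} where

  walkEdges : A → List A → List (A × A)
  walkEdges x [] = []
  walkEdges x (y ∷ ys) = (x , y) ∷ walkEdges y ys

  endpoint : A → List A → A
  endpoint x [] = x
  endpoint x (y ∷ ys) = endpoint y ys

  endpoint∈ : ∀ x xs → endpoint x xs ∈ x ∷ xs
  endpoint∈ x [] = here refl
  endpoint∈ x (y ∷ ys) = there (endpoint∈ y ys)

  endpoint-++ : ∀ a as b bs → endpoint a (as ++ b ∷ bs) ≡ endpoint b bs
  endpoint-++ a [] b bs = refl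
  endpoint-++ a (x ∷ as) b bs = endpoint-++ x as b bs

  walkEdges-++ : ∀ a as b bs → walkEdges a (as ++ b ∷ bs) ≡ walkEdges a as ++ (endpoint a as , b) ∷ walkEdges b bs
  walkEdges-++ a [] b bs = refl
  walkEdges-++ a (x ∷ as) b bs = cong ((a , x) ∷_) (walkEdges-++ x as b bs)

  walkEdges-split : ∀ x xs {u v} → (u , v) ∈ walkEdges x xs →
    ∃₂ λ as bs → xs ≡ as ++ v ∷ bs × endpoint x as ≡ u
  walkEdges-split x (y ∷ ys) (here refl) = [] , ys , refl , refl
  walkEdges-split x (y ∷ ys) (there uv∈) with walkEdges-split y ys uv∈
  ... | as , bs , refl , refl = y ∷ as , bs , refl , refl

  cycEdges-∷ : ∀ x xs → cycEdges (x ∷ xs) ≡ walkEdges x xs ++ (endpoint x xs , x) ∷ []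
  cycEdges-∷ x xs = zip-shift x xs
    where
    zip-shift : ∀ y ys → zip (y ∷ ys) (ys ++ x ∷ []) ≡ walkEdges y ys ++ (endpoint y ys , x) ∷ []
    zip-shift y [] = refl
    zip-shift y (z ∷ zs) = cong ((y , z) ∷_) (zip-shift z zs)

  cycEdges-join : ∀ a as b bs → cycEdges (a ∷ as ++ b ∷ bs) ≡
    walkEdges a as ++ (endpoint a as , b) ∷ walkEdges b bs ++ (endpoint b bs , a) ∷ []
  cycEdges-join a as b bs = begin
    cycEdges (a ∷ as ++ b ∷ bs)
      ≡⟨ cycEdges-∷ a (as ++ b ∷ bs) ⟩
    walkEdges a (as ++ b ∷ bs) ++ (endpoint a (as ++ b ∷ bs) , a) ∷ []
      ≡⟨ cong₂ (λ es z → es ++ (z , a) ∷ []) (walkEdges-++ a as b bs) (endpoint-++ a as b bs) ⟩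
    (walkEdges a as ++ (endpoint a as , b) ∷ walkEdges b bs) ++ (endpoint b bs , a) ∷ []
      ≡⟨ ++-assoc (walkEdges a as) _ _ ⟩
    walkEdges a as ++ (endpoint a as , b) ∷ walkEdges b bs ++ (endpoint b bs , a) ∷ [] ∎
    where open ≡-Reasoning

  cycEdges-rotate : ∀ a as b bs → cycEdges (a ∷ as ++ b ∷ bs) ↭ cycEdges (b ∷ bs ++ a ∷ as)
  cycEdges-rotate a as b bs = begin
    cycEdges (a ∷ as ++ b ∷ bs)            ≡⟨ cycEdges-join a as b bs ⟩
    X ++ e ∷ Y ++ f ∷ []                   ≡⟨ ++-assoc X (e ∷ []) _ ⟨
    (X ++ e ∷ []) ++ Y ++ f ∷ []           ↭⟨ ++-comm (X ++ e ∷ []) (Y ++ f ∷ []) ⟩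
    (Y ++ f ∷ []) ++ X ++ e ∷ []           ≡⟨ ++-assoc Y (f ∷ []) _ ⟩
    Y ++ f ∷ X ++ e ∷ []                   ≡⟨ cycEdges-join b bs a as ⟨
    cycEdges (b ∷ bs ++ a ∷ as)            ∎
    where
    open PermutationReasoning
    X = walkEdges a as
    Y = walkEdges b bs
    e = (endpoint a as , b)
    f = (endpoint b bs , a)

  cycEdges-open : ∀ x xs {u v} → (u , v) ∈ cycEdges (x ∷ xs) →
    ∃ λ ys → endpoint v ys ≡ u × v ∷ ys ↭ x ∷ xs × cycEdges (x ∷ xs) ↭ cycEdges (v ∷ ys)
  cycEdges-open x xs uv∈ with ∈-++⁻ (walkEdges x xs) (subst (_ ∈_) (cycEdges-∷ x xs) uv∈)
  ... | inj₂ (here refl) = xs , refl , ↭-refl , ↭-refl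
  ... | inj₁ uv∈walk with walkEdges-split x xs uv∈walk
  ...   | as , bs , refl , refl =
    bs ++ x ∷ as , endpoint-++ _ bs x as , ++-comm (_ ∷ bs) (x ∷ as) , cycEdges-rotate x as _ bs

  walkEdges-reverse : ∀ b bs → ∃₂ λ c cs →
    c ≡ endpoint b bs × endpoint c cs ≡ b × c ∷ cs ↭ b ∷ bs × walkEdges c cs ↭ map swap (walkEdges b bs)
  walkEdges-reverse b [] = b , [] , refl , refl , ↭-refl , ↭-refl
  walkEdges-reverse b (y ∷ ys) with walkEdges-reverse y ys
  ... | c , cs , c≡ , end≡y , vertices↭ , edges↭ =
    c , cs ++ b ∷ [] , c≡ , endpoint-++ c cs b [] , ↭-trans (↭-sym (∷↭∷ʳ b (c ∷ cs))) (↭.prep b vertices↭) , reversed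
    where
    open PermutationReasoning
    reversed : walkEdges c (cs ++ b ∷ []) ↭ (y , b) ∷ map swap (walkEdges y ys)
    reversed = begin
      walkEdges c (cs ++ b ∷ [])                   ≡⟨ walkEdges-++ c cs b [] ⟩
      walkEdges c cs ++ (endpoint c cs , b) ∷ []   ≡⟨ cong (λ z → walkEdges c cs ++ (z , b) ∷ []) end≡y ⟩
      walkEdges c cs ++ (y , b) ∷ []               ↭⟨ ++⁺ʳ _ edges↭ ⟩
      map swap (walkEdges y ys) ++ (y , b) ∷ []    ↭⟨ ∷↭∷ʳ _ _ ⟨
      (y , b) ∷ map swap (walkEdges y ys)          ∎

  count-cycEdges-∷ : ∀ {Q : A × A → Set} (Q? : Decidable Q) x xs →
    count Q? (cycEdges (x ∷ xs)) ≡ count Q? (walkEdges x xs) + count Q? ((endpoint x xs , x) ∷ [])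
  count-cycEdges-∷ Q? x xs =
    trans (cong (count Q?) (cycEdges-∷ x xs)) (count-++ Q? (walkEdges x xs) _)

  count-cycEdges-join : ∀ {Q : A × A → Set} (Q? : Decidable Q) a as b bs →
    count Q? (cycEdges (a ∷ as ++ b ∷ bs)) ≡
    count Q? (walkEdges a as) + (count Q? ((endpoint a as , b) ∷ []) +
      (count Q? (walkEdges b bs) + count Q? ((endpoint b bs , a) ∷ [])))
  count-cycEdges-join Q? a as b bs = begin
    count Q? (cycEdges (a ∷ as ++ b ∷ bs))            ≡⟨ cong (count Q?) (cycEdges-join a as b bs) ⟩
    count Q? (X ++ e ∷ Y ++ f ∷ [])                   ≡⟨ count-++ Q? X _ ⟩
    count Q? X + count Q? (e ∷ Y ++ f ∷ [])           ≡⟨ cong (count Q? X +_) (count-++ Q? (e ∷ []) _) ⟩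
    count Q? X + (count Q? (e ∷ []) + count Q? (Y ++ f ∷ []))
      ≡⟨ cong (λ k → count Q? X + (count Q? (e ∷ []) + k)) (count-++ Q? Y _) ⟩
    count Q? X + (count Q? (e ∷ []) + (count Q? Y + count Q? (f ∷ []))) ∎
    where
    open ≡-Reasoning
    X = walkEdges a as
    Y = walkEdges b bs
    e = (endpoint a as , b)
    f = (endpoint b bs , a)

module CycleSurgery {n t : ℕ} (G : Graph n) (P : Partition n t) where

  AdjEdge : Fin n × Fin n → Set
  AdjEdge e = Adj G (proj₁ e) (proj₂ e)

  Crossing : Fin n × Fin n → Set
  Crossing (u , v) = P u ≢ P v

  crossing? : Decidable Crossing
  crossing? (u , v) = ¬? (P u ≟ P v)

  crossings : List (Fin n × Fin n) → ℕ
  crossings = count crossing?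

  crossingsOf : Cycle G → ℕ
  crossingsOf C = crossings (edges C)

  crossings-swap : ∀ es → crossings (map swap es) ≡ crossings es
  crossings-swap [] = refl
  crossings-swap ((u , v) ∷ es) with P v ≟ P u | P u ≟ P v
  ... | yes _  | yes _  = crossings-swap es
  ... | no _   | no _   = cong suc (crossings-swap es)
  ... | yes vu | no ¬uv = ⊥-elim (¬uv (sym vu))
  ... | no ¬vu | yes uv = ⊥-elim (¬vu (sym uv))

  Directed : Fin t → Fin t → Fin n × Fin n → Set
  Directed i j (u , v) = P u ≡ i × P v ≡ j

  directed? : ∀ i j → Decidable (Directed i j)
  directed? i j (u , v) = (P u ≟ i) ×-dec (P v ≟ j)

  record Walk : Set where
    field
      start    : Fin n
      rest     : List (Fin n)
      adjacent : All AdjEdge (walkEdges start rest)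

    vertices : List (Fin n)
    vertices = start ∷ rest

    finish : Fin n
    finish = endpoint start rest

    steps : List (Fin n × Fin n)
    steps = walkEdges start rest

  open Walk

  walkEdges-adjacent : ∀ x xs → All AdjEdge (cycEdges (x ∷ xs)) → All AdjEdge (walkEdges x xs)
  walkEdges-adjacent x xs adj = Allₚ.++⁻ˡ (walkEdges x xs) (subst (All AdjEdge) (cycEdges-∷ x xs) adj)

  reverseWalk : (W : Walk) → Σ Walk λ W′ →
    start W′ ≡ finish W × finish W′ ≡ start W × vertices W′ ↭ vertices W × crossings (steps W′) ≡ crossings (steps W)
  reverseWalk W with walkEdges-reverse (start W) (rest W)
  ... | c , cs , c≡ , end≡ , vertices↭ , steps↭ =
    record { start = c ; rest = cs ; adjacent = adjacent′ } ,
    c≡ , end≡ , vertices↭ , trans (count-↭ crossing? steps↭) (crossings-swap (steps W))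
    where
    adjacent′ : All AdjEdge (walkEdges c cs)
    adjacent′ = All-resp-↭ (↭-sym steps↭) (Allₚ.map⁺ (All.map (Graph.sym G) (adjacent W)))

  record IsOpening (W : Walk) (C : Cycle G) : Set where
    field
      vertices-↭ : vertices W ↭ verts C
      edges-↭    : edges C ↭ cycEdges (vertices W)

  open IsOpening

  openCycle : (C : Cycle G) → Σ Walk λ W → IsOpening W C
  openCycle record { verts = [] ; len≥3 = () }
  openCycle record { verts = x ∷ xs ; adjacent = adj } =
    record { start = x ; rest = xs ; adjacent = walkEdges-adjacent x xs adj } , record { vertices-↭ = ↭-refl ; edges-↭ = ↭-refl }

  openAt : (C : Cycle G) → ∀ {u v} → (u , v) ∈ edges C →
    Σ Walk λ W → IsOpening W C × finish W ≡ u × start W ≡ v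
  openAt record { verts = [] ; len≥3 = () }
  openAt record { verts = x ∷ xs ; adjacent = adj } uv∈ with cycEdges-open x xs uv∈
  ... | ys , end≡u , vertices↭ , edges↭ =
    record { start = _ ; rest = ys ; adjacent = walkEdges-adjacent _ ys (All-resp-↭ edges↭ adj) } ,
    record { vertices-↭ = vertices↭ ; edges-↭ = edges↭ } , end≡u , refl

  walkEdges-adjacent-split : ∀ a as b bs → All AdjEdge (walkEdges a (as ++ b ∷ bs)) →
    All AdjEdge (walkEdges a as) × All AdjEdge (walkEdges b bs)
  walkEdges-adjacent-split a as b bs adj with Allₚ.++⁻ (walkEdges a as) (subst (All AdjEdge) (walkEdges-++ a as b bs) adj)
  ... | adj-as , _ ∷ adj-bs = adj-as , adj-bs

  count-opening : ∀ {Q} (Q? : Decidable Q) {W C} → IsOpening W C →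
    count Q? (edges C) ≡ count Q? (steps W) + count Q? ((finish W , start W) ∷ [])
  count-opening Q? {W} op = trans (count-↭ Q? (edges-↭ op)) (count-cycEdges-∷ Q? (start W) (rest W))

  crossings-opening-≤ : ∀ {W C} → IsOpening W C → crossings (steps W) ≤ crossingsOf C
  crossings-opening-≤ op = ≤-trans (m≤m+n _ _) (≤-reflexive (sym (count-opening crossing? op)))

  cycleOn : ∀ ws {vs} → ws ↭ vs → Unique vs → 3 ≤ length vs → All AdjEdge (cycEdges ws) → Cycle G
  cycleOn ws ws↭vs unique len adj = record
    { verts    = ws
    ; len≥3    = subst (3 ≤_) (sym (↭-length ws↭vs)) len
    ; distinct = Unique-resp-↭ (↭-sym ws↭vs) unique
    ; adjacent = adj
    }

  directed⇒crossing : ∀ {i j e} → i ≢ j → Directed i j e → Crossing e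
  directed⇒crossing i≢j (refl , refl) eq = i≢j eq

  module Rewiring (cliques : PartsAreCliques G P) where

    joinForward : (A B : Walk) {vs : List (Fin n)} → vertices A ++ vertices B ↭ vs → Unique vs → 3 ≤ length vs →
      P (finish A) ≡ P (start B) → P (finish B) ≡ P (start A) →
      Σ (Cycle G) λ N → verts N ↭ vs × crossingsOf N ≡ crossings (steps A) + crossings (steps B)
    joinForward A B ↭vs unique len AB BA = cycleOn (vertices A ++ vertices B) ↭vs unique len adjacent′ , ↭vs , cost
      where
      disjoint : ∀ {v} → v ∈ vertices A → v ∉ vertices B
      disjoint = proj₂ (Unique-++⁻ (vertices A) (Unique-resp-↭ (↭-sym ↭vs) unique))
      A≢B : finish A ≢ start B
      A≢B eq = disjoint (endpoint∈ (start A) (rest A)) (here eq)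
      B≢A : finish B ≢ start A
      B≢A eq = disjoint (here refl) (subst (_∈ vertices B) eq (endpoint∈ (start B) (rest B)))
      adjacent′ : All AdjEdge (cycEdges (vertices A ++ vertices B))
      adjacent′ = subst (All AdjEdge) (sym (cycEdges-join (start A) (rest A) (start B) (rest B)))
        (Allₚ.++⁺ (adjacent A) (cliques _ _ A≢B AB ∷ Allₚ.++⁺ (adjacent B) (cliques _ _ B≢A BA ∷ [])))
      open ≡-Reasoning
      cost : crossings (cycEdges (vertices A ++ vertices B)) ≡ crossings (steps A) + crossings (steps B)
      cost = begin
        crossings (cycEdges (vertices A ++ vertices B))
          ≡⟨ count-cycEdges-join crossing? (start A) (rest A) (start B) (rest B) ⟩
        crossings (steps A) + (crossings ((finish A , start B) ∷ []) + (crossings (steps B) + crossings ((finish B , start A) ∷ [])))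
          ≡⟨ cong₂ (λ p q → crossings (steps A) + (p + (crossings (steps B) + q)))
               (count-reject crossing? [] (λ ≢ → ≢ AB)) (count-reject crossing? [] (λ ≢ → ≢ BA)) ⟩
        crossings (steps A) + (crossings (steps B) + 0)
          ≡⟨ cong (crossings (steps A) +_) (+-identityʳ _) ⟩
        crossings (steps A) + crossings (steps B) ∎

    -- In the second case B is reversed before closing up.
    Joinable : Walk → Walk → Set
    Joinable A B = (P (finish A) ≡ P (start B) × P (finish B) ≡ P (start A))
                 ⊎ (P (finish A) ≡ P (finish B) × P (start A) ≡ P (start B))

    join : (A B : Walk) → Joinable A B → ∀ {vs} → vertices A ++ vertices B ↭ vs → Unique vs → 3 ≤ length vs →
      Σ (Cycle G) λ N → verts N ↭ vs × crossingsOf N ≡ crossings (steps A) + crossings (steps B)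
    join A B (inj₁ (AB , BA)) ↭vs unique len = joinForward A B ↭vs unique len AB BA
    join A B (inj₂ (AB , AB′)) ↭vs unique len with reverseWalk B
    ... | B′ , start≡ , finish≡ , vertices↭ , crossings≡
      with joinForward A B′ (↭-trans (++⁺ˡ (vertices A) vertices↭) ↭vs) unique len
             (trans AB (cong P (sym start≡))) (trans (cong P finish≡) (sym AB′))
    ...   | N , N↭ , cost = N , N↭ , trans cost (cong (crossings (steps A) +_) crossings≡)

    Rerouting : Cycle G → Set
    Rerouting C = Σ (Cycle G) λ N → verts N ↭ verts C × crossingsOf N < crossingsOf C

    Merger : Cycle G → Cycle G → Set
    Merger C D = Σ (Cycle G) λ N → verts N ↭ verts C ++ verts D × crossingsOf N ≤ crossingsOf C + crossingsOf D

    mergeOpenings : ∀ {A B C D} → IsOpening A C → IsOpening B D → Disjoint C D → Joinable A B → Merger C D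
    mergeOpenings {A} {B} {C} {D} opA opB C∩D=∅ joinable
      with join A B joinable (++⁺ (vertices-↭ opA) (vertices-↭ opB))
             (Uniqueₚ.++⁺ (distinct C) (distinct D) λ (v∈C , v∈D) → C∩D=∅ _ v∈C v∈D)
             (≤-trans (len≥3 C) (length-++-≤ˡ (verts C)))
    ... | N , N↭ , cost =
      N , N↭ , ≤-trans (≤-reflexive cost) (+-mono-≤ (crossings-opening-≤ opA) (crossings-opening-≤ opB))

    mergeInPart : ∀ {i} (C D : Cycle G) → Disjoint C D → InsidePart P i C → InsidePart P i D → Merger C D
    mergeInPart C D C∩D=∅ C⊆Vᵢ D⊆Vᵢ with openCycle C | openCycle D
    ... | A , opA | B , opB = mergeOpenings opA opB C∩D=∅
      (inj₁ (trans (inPart opA C⊆Vᵢ (endpoint∈ _ _)) (sym (inPart opB D⊆Vᵢ (here refl))) ,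
             trans (inPart opB D⊆Vᵢ (endpoint∈ _ _)) (sym (inPart opA C⊆Vᵢ (here refl)))))
      where
      inPart : ∀ {i W C v} → IsOpening W C → InsidePart P i C → v ∈ vertices W → P v ≡ i
      inPart op inside v∈W = All.lookup inside (∈-resp-↭ (vertices-↭ op) v∈W)

    mergeAcross : ∀ {i j} (C D : Cycle G) → Disjoint C D → MeetsCross P i j C → MeetsCross P i j D → Merger C D
    mergeAcross C D C∩D=∅ C-meets D-meets with find C-meets | find D-meets
    ... | (u , v) , uv∈C , uv-crosses | (u′ , v′) , uv′∈D , uv′-crosses with openAt C uv∈C | openAt D uv′∈D
    ... | A , opA , refl , refl | B , opB , refl , refl =
      mergeOpenings opA opB C∩D=∅ (orientations uv-crosses uv′-crosses)
      where
      orientations : ∀ {i j u v u′ v′} → Crosses P i j (u , v) → Crosses P i j (u′ , v′) →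
        (P u ≡ P v′ × P u′ ≡ P v) ⊎ (P u ≡ P u′ × P v ≡ P v′)
      orientations (inj₁ (refl , refl)) (inj₁ (u′i , v′j)) = inj₂ (sym u′i , sym v′j)
      orientations (inj₁ (refl , refl)) (inj₂ (u′j , v′i)) = inj₁ (sym v′i , u′j)
      orientations (inj₂ (refl , refl)) (inj₁ (u′i , v′j)) = inj₁ (sym v′j , u′i)
      orientations (inj₂ (refl , refl)) (inj₂ (u′j , v′i)) = inj₂ (sym u′j , sym v′i)

    -- Both junctions run from Vᵢ to Vⱼ, so A followed by B reversed only uses junctions inside parts.
    untangle : ∀ {i j} → i ≢ j → (A B : Walk) → Directed i j (finish A , start B) → Directed i j (finish B , start A) →
      ∀ {vs} → vertices A ++ vertices B ↭ vs → Unique vs → 3 ≤ length vs →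
      Σ (Cycle G) λ N → verts N ↭ vs × crossingsOf N < crossings (cycEdges (vertices A ++ vertices B))
    untangle i≢j A B AB↗@(PAi , PBj) BA↗@(PBi , PAj) ↭vs unique len
      with join A B (inj₂ (trans PAi (sym PBi) , trans PAj (sym PBj))) ↭vs unique len
    ... | N , N↭ , cost = N , N↭ , (begin-strict
      crossingsOf N                                    ≡⟨ cost ⟩
      crossings (steps A) + crossings (steps B)        <⟨ +-monoʳ-< (crossings (steps A)) (s≤s (m≤m+n _ 1)) ⟩
      crossings (steps A) + (1 + (crossings (steps B) + 1))
        ≡⟨ cong₂ (λ p q → crossings (steps A) + (p + (crossings (steps B) + q)))
             (count-accept crossing? [] (directed⇒crossing i≢j AB↗)) (count-accept crossing? [] (directed⇒crossing i≢j BA↗)) ⟨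
      crossings (steps A) + (crossings ((finish A , start B) ∷ []) + (crossings (steps B) + crossings ((finish B , start A) ∷ [])))
        ≡⟨ count-cycEdges-join crossing? (start A) (rest A) (start B) (rest B) ⟨
      crossings (cycEdges (vertices A ++ vertices B)) ∎)
      where open ≤-Reasoning hiding (start)

    rerouteDirected : ∀ {i j} → i ≢ j → (C : Cycle G) → 2 ≤ count (directed? i j) (edges C) → Rerouting C
    rerouteDirected {i} {j} i≢j C twice
      with find (count>0⇒Any (directed? i j) (edges C) (≤-trans (s≤s z≤n) twice))
    ... | (u , v) , uv∈C , uv↗ with openAt C uv∈C
    ... | W@record { start = x ; rest = xs ; adjacent = adj } , op , refl , refl
      with find (count>0⇒Any (directed? i j) (walkEdges x xs) once)
      where
      once : 1 ≤ count (directed? i j) (walkEdges x xs)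
      once = +-cancelʳ-≤ 1 1 _ (begin
        2                                                          ≤⟨ twice ⟩
        count (directed? i j) (edges C)                            ≡⟨ count-opening (directed? i j) op ⟩
        count (directed? i j) (steps W) + count (directed? i j) ((finish W , start W) ∷ [])
                                                                   ≤⟨ +-monoʳ-≤ _ (count-[x]≤1 (directed? i j) _) ⟩
        count (directed? i j) (steps W) + 1                        ∎)
        where open ≤-Reasoning hiding (start)
    ...   | (u′ , v′) , uv′∈W , uv′↗ with walkEdges-split x xs uv′∈W
    ...     | as , bs , refl , refl with walkEdges-adjacent-split x as v′ bs adj
    ...       | adj-as , adj-bs
      with untangle i≢j (record { start = x ; rest = as ; adjacent = adj-as })
             (record { start = v′ ; rest = bs ; adjacent = adj-bs })
             uv′↗ (subst (λ z → Directed i j (z , x)) (endpoint-++ x as v′ bs) uv↗)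
             (vertices-↭ op) (distinct C) (len≥3 C)
    ...         | N , N↭ , fewer = N , N↭ , ≤-trans fewer (≤-reflexive (sym (count-↭ crossing? (edges-↭ op))))

    reroute : ∀ {i j} → i ≢ j → (C : Cycle G) → 3 ≤ crossCount P i j C → Rerouting C
    reroute {i} {j} i≢j C thrice
      with 3≤m+n⇒2≤m⊎2≤n _ _ (≤-trans thrice
             (count-⊎ (crosses? P i j) (directed? i j) (directed? j i) (λ { (u , v) uv-crosses → uv-crosses }) (edges C)))
    ... | inj₁ twice = rerouteDirected i≢j C twice
    ... | inj₂ twice = rerouteDirected (i≢j ∘ sym) C twice

module _ {n} {G : Graph n} where

  Two : (Cycle G → Set) → List (Cycle G) → Set
  Two Q cs = ∃₂ λ C D → ∃ λ rest → cs ↭ C ∷ D ∷ rest × Q C × Q D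

  atMostOne-or-two : ∀ {Q} → Decidable Q → ∀ cs → AtMostOne Q cs ⊎ Two Q cs
  atMostOne-or-two Q? [] = inj₁ λ ()
  atMostOne-or-two Q? (C ∷ cs) with atMostOne-or-two Q? cs
  ... | inj₂ (D , E , rest , cs↭ , QD , QE) =
    inj₂ (D , E , C ∷ rest , ↭-trans (↭.prep C cs↭) (shifts (C ∷ []) (D ∷ E ∷ [])) , QD , QE)
  ... | inj₁ atMostOne with Q? C | any? Q? cs
  ...   | no ¬QC | _ = inj₁ λ
    { zero _ QC _ → ⊥-elim (¬QC QC)
    ; (suc a) zero _ QC → ⊥-elim (¬QC QC)
    ; (suc a) (suc b) Qa Qb → cong suc (atMostOne a b Qa Qb) }
  ...   | yes QC | no none = inj₁ λ
    { zero zero _ _ → refl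
    ; zero (suc b) _ Qb → ⊥-elim (none (lose (∈-lookup b) Qb))
    ; (suc a) zero Qa _ → ⊥-elim (none (lose (∈-lookup a) Qa))
    ; (suc a) (suc b) Qa Qb → cong suc (atMostOne a b Qa Qb) }
  ...   | yes QC | yes some with find some
  ...     | D , D∈cs , QD with ∈⇒↭ D∈cs
  ...       | rest , cs↭ = inj₂ (C , D , rest , ↭.prep C cs↭ , QC , QD)

  -- V(𝒞) with multiplicities: 𝒞 is vertex-disjoint iff V 𝒞 is duplicate-free, so a
  -- permutation of V 𝒞 preserves both disjointness and the vertex set.
  V : List (Cycle G) → List (Fin n)
  V = concatMap verts

  InV-↭ : ∀ {cs′ cs} → V cs′ ↭ V cs → ∀ v → InV cs′ v ⇔ InV cs v
  InV-↭ V↭ v = mk⇔ (∈-concatMap⁻ verts ∘ ∈-resp-↭ V↭ ∘ ∈-concatMap⁺ verts)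
                   (∈-concatMap⁻ verts ∘ ∈-resp-↭ (↭-sym V↭) ∘ ∈-concatMap⁺ verts)

  vertexDisjoint⇒unique : ∀ {cs} → VertexDisjoint cs → Unique (V cs)
  vertexDisjoint⇒unique disjoint = Uniqueₚ.concat⁺ (Allₚ.map⁺ (All.tabulate λ {C} _ → distinct C))
    (AllPairsₚ.map⁺ (AllPairs.map (λ C∩D=∅ {v} (v∈C , v∈D) → C∩D=∅ v v∈C v∈D) disjoint))

  unique⇒vertexDisjoint : ∀ cs → Unique (V cs) → VertexDisjoint cs
  unique⇒vertexDisjoint [] _ = []
  unique⇒vertexDisjoint (C ∷ cs) unique with Unique-++⁻ (verts C) unique
  ... | unique-cs , C∩cs=∅ =
    All.tabulate (λ D∈cs v v∈C v∈D → C∩cs=∅ v∈C (∈-concatMap⁺ verts (lose D∈cs v∈D))) ∷ unique⇒vertexDisjoint cs unique-cs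

module Normalisation {n t} (G : Graph n) (P : Partition n t) (cliques : PartsAreCliques G P) where

  open CycleSurgery G P
  open Rewiring cliques

  potential : List (Cycle G) → ℕ
  potential cs = length cs + sum (map crossingsOf cs)

  potential-↭ : ∀ {cs ds} → cs ↭ ds → potential cs ≡ potential ds
  potential-↭ cs↭ds = cong₂ _+_ (↭-length cs↭ds) (sum-↭ (map⁺ crossingsOf cs↭ds))

  record _≼_ (cs′ cs : List (Cycle G)) : Set where
    field
      vertices-↭ : V cs′ ↭ V cs
      length-≤   : length cs′ ≤ length cs

  open _≼_

  ≼-refl : ∀ {cs} → cs ≼ cs
  ≼-refl = record { vertices-↭ = ↭-refl ; length-≤ = ≤-refl }

  ≼-trans : ∀ {cs″ cs′ cs} → cs″ ≼ cs′ → cs′ ≼ cs → cs″ ≼ cs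
  ≼-trans p q = record
    { vertices-↭ = ↭-trans (vertices-↭ p) (vertices-↭ q)
    ; length-≤   = ≤-trans (length-≤ p) (length-≤ q) }

  _≺_ : List (Cycle G) → List (Cycle G) → Set
  cs′ ≺ cs = cs′ ≼ cs × potential cs′ < potential cs

  merge-≺ : ∀ {Q cs} → Unique (V cs) → Two Q cs →
    (∀ {C D} → Disjoint C D → Q C → Q D → Merger C D) → ∃ (_≺ cs)
  merge-≺ {cs = cs} unique (C , D , rest , cs↭ , QC , QD) merge with merge C∩D=∅ QC QD
    where
    C∩D=∅ : Disjoint C D
    C∩D=∅ v v∈C v∈D = proj₂ (Unique-++⁻ (verts C) (Unique-resp-↭ (concatMap-↭ verts cs↭) unique))
      v∈C (∈-++⁺ˡ v∈D)
  ... | N , N↭ , cost = N ∷ rest , record { vertices-↭ = vertices↭ ; length-≤ = shorter } , lower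
    where
    vertices↭ : V (N ∷ rest) ↭ V cs
    vertices↭ = begin
      verts N ++ V rest                 ↭⟨ ++⁺ʳ (V rest) N↭ ⟩
      (verts C ++ verts D) ++ V rest    ≡⟨ ++-assoc (verts C) (verts D) (V rest) ⟩
      V (C ∷ D ∷ rest)                  ↭⟨ concatMap-↭ verts cs↭ ⟨
      V cs                              ∎
      where open PermutationReasoning
    shorter : length (N ∷ rest) ≤ length cs
    shorter = ≤-trans (n≤1+n _) (≤-reflexive (sym (↭-length cs↭)))
    lower : potential (N ∷ rest) < potential cs
    lower = begin-strict
      suc (length rest) + (crossingsOf N + sum (map crossingsOf rest))
        <⟨ +-mono-<-≤ (≤-refl {suc (suc (length rest))}) (+-monoˡ-≤ (sum (map crossingsOf rest)) cost) ⟩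
      suc (suc (length rest)) + ((crossingsOf C + crossingsOf D) + sum (map crossingsOf rest))
        ≡⟨ cong (suc (suc (length rest)) +_) (+-assoc (crossingsOf C) _ _) ⟩
      potential (C ∷ D ∷ rest)          ≡⟨ potential-↭ cs↭ ⟨
      potential cs                      ∎
      where open ≤-Reasoning

  replace-≺ : ∀ {cs C rest} → cs ↭ C ∷ rest → Rerouting C → ∃ (_≺ cs)
  replace-≺ {cs} {C} {rest} cs↭ (N , N↭ , fewer) =
    N ∷ rest , record { vertices-↭ = vertices↭ ; length-≤ = ≤-reflexive (sym (↭-length cs↭)) } , lower
    where
    vertices↭ : V (N ∷ rest) ↭ V cs
    vertices↭ = ↭-trans (++⁺ʳ (V rest) N↭) (concatMap-↭ verts (↭-sym cs↭))
    lower : potential (N ∷ rest) < potential cs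
    lower = begin-strict
      potential (N ∷ rest)     <⟨ +-mono-≤-< (≤-refl {length (N ∷ rest)}) (+-monoˡ-< (sum (map crossingsOf rest)) fewer) ⟩
      potential (C ∷ rest)     ≡⟨ potential-↭ cs↭ ⟨
      potential cs             ∎
      where open ≤-Reasoning

  Normal : List (Cycle G) → Set
  Normal cs = (∀ i → AtMostOne (InsidePart P i) cs)
    × (∀ i j → i ≢ j → AtMostOne (MeetsCross P i j) cs
                     × (∀ a → MeetsCross P i j (lookup cs a) → crossCount P i j (lookup cs a) ≤ 2))

  insideParts-or-≺ : ∀ cs → Unique (V cs) → (∀ i → AtMostOne (InsidePart P i) cs) ⊎ ∃ (_≺ cs)
  insideParts-or-≺ cs unique = Fin-∀-⊎ λ i →
    map₂ (λ two → merge-≺ unique two (λ {C} {D} → mergeInPart C D))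
         (atMostOne-or-two (λ C → all? (λ v → P v ≟ i) (verts C)) cs)

  meetCrossings-or-≺ : ∀ cs → Unique (V cs) → (∀ i j → i ≢ j → AtMostOne (MeetsCross P i j) cs) ⊎ ∃ (_≺ cs)
  meetCrossings-or-≺ cs unique = Fin-∀≢-⊎ λ i j _ →
    map₂ (λ two → merge-≺ unique two (λ {C} {D} → mergeAcross C D))
         (atMostOne-or-two (λ C → any? (crosses? P i j) (edges C)) cs)

  crossCounts-or-≺ : ∀ cs → (∀ i j → i ≢ j → All (λ C → crossCount P i j C ≤ 2) cs) ⊎ ∃ (_≺ cs)
  crossCounts-or-≺ cs = Fin-∀≢-⊎ boundedOrReroute
    where
    boundedOrReroute : ∀ i j → i ≢ j → All (λ C → crossCount P i j C ≤ 2) cs ⊎ ∃ (_≺ cs)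
    boundedOrReroute i j i≢j with all? (λ C → crossCount P i j C ≤? 2) cs
    ... | yes bounded = inj₁ bounded
    ... | no unbounded with find (Allₚ.¬All⇒Any¬ (λ C → crossCount P i j C ≤? 2) cs unbounded)
    ...   | C , C∈cs , C-unbounded with ∈⇒↭ C∈cs
    ...     | rest , cs↭ = inj₂ (replace-≺ cs↭ (reroute i≢j C (≰⇒> C-unbounded)))

  normal-or-≺ : ∀ cs → Unique (V cs) → Normal cs ⊎ ∃ (_≺ cs)
  normal-or-≺ cs unique with insideParts-or-≺ cs unique | meetCrossings-or-≺ cs unique | crossCounts-or-≺ cs
  ... | inj₂ better | _ | _ = inj₂ better
  ... | inj₁ _ | inj₂ better | _ = inj₂ better
  ... | inj₁ _ | inj₁ _ | inj₂ better = inj₂ better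
  ... | inj₁ insides | inj₁ meets | inj₁ bounded =
    inj₁ (insides , λ i j i≢j → meets i j i≢j , λ a _ → All.lookup (bounded i j i≢j) (∈-lookup a))

  normalise : ∀ cs → Unique (V cs) → ∃ λ cs′ → Normal cs′ × cs′ ≼ cs
  normalise cs = go cs (<-wellFounded (potential cs))
    where
    go : ∀ cs → Acc _<_ (potential cs) → Unique (V cs) → ∃ λ cs′ → Normal cs′ × cs′ ≼ cs
    go cs (acc lower) unique with normal-or-≺ cs unique
    ... | inj₁ normal = cs , normal , ≼-refl
    ... | inj₂ (cs′ , cs′≼cs , decrease)
      with go cs′ (lower decrease) (Unique-resp-↭ (↭-sym (vertices-↭ cs′≼cs)) unique)
    ...   | cs″ , normal , cs″≼cs′ = cs″ , normal , ≼-trans cs″≼cs′ cs′≼cs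

claim5p3 : ∀ {n t} (G : Graph n) (P : Partition n t) → PartsAreCliques G P →
    (cs : List (Cycle G)) → 1 ≤ length cs → VertexDisjoint cs →
    Σ (List (Cycle G)) λ cs′ →
      VertexDisjoint cs′ × length cs′ ≤ length cs × (∀ v → InV cs′ v ⇔ InV cs v)
      × (∀ (i : Fin t) → AtMostOne (InsidePart P i) cs′)
      × (∀ (i j : Fin t) → i ≢ j →
           AtMostOne (MeetsCross P i j) cs′
           × (∀ a → MeetsCross P i j (lookup cs′ a) → crossCount P i j (lookup cs′ a) ≤ 2))
claim5p3 G P cliques cs _ disjoint with normalise cs (vertexDisjoint⇒unique disjoint)
  where open Normalisation G P cliques
... | cs′ , normal , record { vertices-↭ = V↭ ; length-≤ = shorter } =
  cs′ , unique⇒vertexDisjoint cs′ (Unique-resp-↭ (↭-sym V↭) (vertexDisjoint⇒unique disjoint)) ,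
  shorter , InV-↭ V↭ , normal
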